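{- For any $k$ there exist process templates $A,B$ with $|B|=k$ such that the disjunctive system $(A,B)^{(1,|B|-1)}$ does not have a deadlock, but the disjunctive system $(A,B)^{(1,|B|)}$ does.
   Context: A process template is $U=(Q_U,\mathrm{init}_U,\Sigma_U,\delta_U)$ with finite state set $Q_U$ containing initial state $\mathrm{init}_U$, finite input alphabet $\Sigma_U$, and guarded transition relation $\delta_U \subseteq Q_U \times \Sigma_U \times \mathcal{P}(Q_A \cup Q_B) \times Q_U$. $Q_A,Q_B$ are disjoint, as are the alphabets; $|B|=|Q_B|$. The system $(A,B)^{(1,n)}$ consists of one copy of $A$ and $n$ copies $B_1,\dots,B_n$ of $B$ in interleaving composition, starting with all processes in their initial states. A local transition $(q,\sigma,g,q')$ of process $p$ is enabled in global state $s$ with global input $e$ if $s(p)=q$, $e(p)=\sigma$ and (disjunctive interpretation) some process $p'\neq p$ has $s(p')\in g$. A process is enabled if one of its transitions is enabled; each global step moves exactly one process along an enabled local transition. A run is a maximal sequence of configurations $(s_t,e_t,p_t)$ from the initial state ($p_t$ is the moving process; a configuration $(s,e,\bot)$ occurs exactly when all processes are disabled), in which the input to a process changes only at moments at which that process moves. A run is globally deadlocked if it is finite, locally deadlocked if it is infinite and some process is disabled at all moments from some point on; a system has a deadlock if it has a locally or globally deadlocked run. -}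

module Defs where

open import Data.Nat using (ℕ; _≤_)
open import Data.Fin using (Fin)
open import Data.Bool using (Bool; true)
open import Data.Sum using (_⊎_; inj₁; inj₂)
open import Data.Product using (Σ; ∃; _×_; _,_)
open import Data.Maybe using (Maybe; just; nothing)
open import Data.List using (List)
open import Data.List.Membership.Propositional using (_∈_)
open import Relation.Binary.PropositionalEquality using (_≡_; _≢_)
open import Relation.Nullary using (¬_)

record Trans (Q Σ' G : Set) : Set where
  constructor trans
  field
    src : Q
    lab : Σ'
    grd : G
    tgt : Q

-- States: Q_A = Fin qA, Q_B = Fin qB (so |B| = |Q_B| = qB);
-- inputs: Σ_A = Fin σA, Σ_B = Fin σB (disjointness is built in via the
-- disjoint union / separate types).
-- A guard is a subset of Q_A ∪ Q_B (disjoint union), given by its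
-- characteristic function.
record Templates : Set where
  field
    qA qB σA σB : ℕ
    initA : Fin qA
    initB : Fin qB
    δA : List (Trans (Fin qA) (Fin σA) (Fin qA ⊎ Fin qB → Bool))
    δB : List (Trans (Fin qB) (Fin σB) (Fin qA ⊎ Fin qB → Bool))

-- The system (A,B)^(1,n): one copy of A and n copies of B.
data Proc (n : ℕ) : Set where
  pA : Proc n
  pB : Fin n → Proc n

module System (T : Templates) (n : ℕ) where
  open Templates T

  St : Proc n → Set
  St pA     = Fin qA
  St (pB _) = Fin qB

  Inp : Proc n → Set
  Inp pA     = Fin σA
  Inp (pB _) = Fin σB

  GState : Set
  GState = (p : Proc n) → St p

  GInput : Set
  GInput = (p : Proc n) → Inp p

  stU : (s : GState) → Proc n → Fin qA ⊎ Fin qB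
  stU s pA     = inj₁ (s pA)
  stU s (pB i) = inj₂ (s (pB i))

  initState : GState
  initState pA     = initA
  initState (pB _) = initB

  GuardSat : GState → Proc n → (Fin qA ⊎ Fin qB → Bool) → Set
  GuardSat s p g = ∃ λ p' → p' ≢ p × g (stU s p') ≡ true

  data EnabledTo (s : GState) (e : GInput) : (p : Proc n) → St p → Set where
    viaA : (t : Trans (Fin qA) (Fin σA) (Fin qA ⊎ Fin qB → Bool)) → t ∈ δA →
           Trans.src t ≡ s pA → Trans.lab t ≡ e pA → GuardSat s pA (Trans.grd t) →
           EnabledTo s e pA (Trans.tgt t)
    viaB : (i : Fin n) (t : Trans (Fin qB) (Fin σB) (Fin qA ⊎ Fin qB → Bool)) → t ∈ δB →
           Trans.src t ≡ s (pB i) → Trans.lab t ≡ e (pB i) → GuardSat s (pB i) (Trans.grd t) →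
           EnabledTo s e (pB i) (Trans.tgt t)

  Enabled : GState → GInput → Proc n → Set
  Enabled s e p = ∃ λ q' → EnabledTo s e p q'

  Step : GState → GInput → Proc n → GState → Set
  Step s e p s' = EnabledTo s e p (s' p) × (∀ p' → p' ≢ p → s' p' ≡ s p')

  record Config : Set where
    constructor cfg
    field
      st  : GState
      inp : GInput
      mv  : Maybe (Proc n)   -- nothing = ⊥
  open Config public

  MovesAt : (ℕ → Config) → ℕ → Set
  MovesAt c t = (∃ λ p → mv (c t) ≡ just p × Step (st (c t)) (inp (c t)) p (st (c (ℕ.suc t))))
              × (∀ p → mv (c t) ≢ just p → inp (c (ℕ.suc t)) p ≡ inp (c t) p)

  StartsInit : (ℕ → Config) → Set
  StartsInit c = ∀ p → st (c 0) p ≡ initState p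

  InfiniteRun : (ℕ → Config) → Set
  InfiniteRun c = StartsInit c × (∀ t → MovesAt c t)

  -- a finite run with configurations at moments 0..L; the last one is
  -- (s, e, ⊥) with all processes disabled (values of c beyond L are irrelevant)
  FiniteRun : ℕ → (ℕ → Config) → Set
  FiniteRun L c = StartsInit c
                × (∀ t → ℕ.suc t ≤ L → MovesAt c t)
                × mv (c L) ≡ nothing
                × (∀ p → ¬ Enabled (st (c L)) (inp (c L)) p)

  GloballyDeadlocked : Set
  GloballyDeadlocked = Σ ℕ λ L → Σ (ℕ → Config) λ c → FiniteRun L c

  LocallyDeadlocked : Set
  LocallyDeadlocked = Σ (ℕ → Config) λ c → InfiniteRun c ×
    (∃ λ p → ∃ λ T₀ → ∀ t → T₀ ≤ t → ¬ Enabled (st (c t)) (inp (c t)) p)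

  HasDeadlock : Set
  HasDeadlock = GloballyDeadlocked ⊎ LocallyDeadlocked

HasDeadlock : Templates → ℕ → Set
HasDeadlock T n = System.HasDeadlock T n

-- A is a counter 0, 1, …, K (K = |B|) that may step from j to j + 1
-- only while some B sits in state j; every process has an idle loop, A's
-- guarded by "some B exists" and B's by "A is below K"; and a B in state 0
-- may jump to any state provided another B is in state 0 too.
-- With K − 1 copies of B every state below A's is occupied by some B (the
-- only B that ever leaves a state is a B leaving 0 while another stays
-- there), so by pigeonhole A never reaches K and all idle loops stay
-- enabled.  With K copies, B_i jumps to i for 0 < i < K, A climbs to K,
-- and then no process can move.
module Submission where

open import Defs renaming (trans to transition)
open import Data.Nat using (ℕ; zero; suc; _+_; _≤_; _<_; _∸_; z≤n; s≤s; _≤?_; _<?_)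
open import Data.Nat.Properties using (≤-refl; <⇒≤; <-irrefl; ≤∧≢⇒<; <⇒≱; ≰⇒>; ≤-reflexive; m≤n⇒m≤1+n; m<1+n⇒m<n∨m≡n)
open import Data.Fin using (Fin; zero; suc; toℕ; fromℕ; fromℕ<; inject₁; lower₁; _≟_)
open import Data.Fin.Properties using (toℕ<n; toℕ-injective; toℕ-fromℕ; toℕ-fromℕ<; toℕ-inject₁; inject₁-lower₁; fromℕ≢inject₁; toℕ≤pred[n]; pigeonhole)
open import Data.Fin.Induction using (<-weakInduction)
open import Data.Bool using (Bool; true; false; if_then_else_)
open import Data.Sum using (_⊎_; inj₁; inj₂; [_,_]′)
open import Data.Product using (Σ; ∃; _×_; _,_; proj₁; proj₂)
open import Data.Maybe using (Maybe; just; nothing)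
open import Data.List using (List; map; _++_; allFin)
open import Data.List.Membership.Propositional using (_∈_)
open import Data.List.Membership.Propositional.Properties using (∈-map⁻; ∈-map⁺; ∈-++⁻; ∈-++⁺ˡ; ∈-++⁺ʳ; ∈-allFin)
open import Function using (const; _∘_)
open import Relation.Binary.Construct.Closure.ReflexiveTransitive using (Star; ε; _◅_; _◅◅_)
open import Relation.Nullary using (¬_; Dec; yes; no; does; contradiction)
open import Relation.Nullary.Decidable using (dec-true; dec-false)
open import Relation.Binary.PropositionalEquality using (_≡_; _≢_; refl; sym; trans; cong; subst)

does-sound : ∀ {P : Set} (P? : Dec P) → does P? ≡ true → P
does-sound (yes p) _ = p

no-surjection-onto-larger : ∀ {m n} → n < m → (f : Fin n → Fin m) → ¬ (∀ y → ∃ λ x → f x ≡ y)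
no-surjection-onto-larger n<m f surj
  with i , j , i<j , gᵢ≡gⱼ ← pigeonhole n<m (proj₁ ∘ surj)
  = <-irrefl (cong toℕ i≡j) i<j
  where
    i≡j : i ≡ j
    i≡j = trans (sym (proj₂ (surj i))) (trans (cong f gᵢ≡gⱼ) (proj₂ (surj j)))

allFin₂ : ∀ {m} {X : Set} → (Fin m → X) → (Fin m → X) → List X
allFin₂ f g = map f (allFin _) ++ map g (allFin _)

∈-allFin₂ˡ : ∀ {m} {X : Set} (f g : Fin m → X) j → f j ∈ allFin₂ f g
∈-allFin₂ˡ f g j = ∈-++⁺ˡ (∈-map⁺ f (∈-allFin j))

∈-allFin₂ʳ : ∀ {m} {X : Set} (f g : Fin m → X) j → g j ∈ allFin₂ f g
∈-allFin₂ʳ f g j = ∈-++⁺ʳ (map f (allFin _)) (∈-map⁺ g (∈-allFin j))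

∈-allFin₂⁻ : ∀ {m} {X : Set} (f g : Fin m → X) {x} → x ∈ allFin₂ f g → ∃ λ j → x ≡ f j ⊎ x ≡ g j
∈-allFin₂⁻ f g x∈ with ∈-++⁻ (map f (allFin _)) x∈
... | inj₁ x∈f with j , _ , x≡fj ← ∈-map⁻ f x∈f = j , inj₁ x≡fj
... | inj₂ x∈g with j , _ , x≡gj ← ∈-map⁻ _ x∈g = j , inj₂ x≡gj

module Executions (T : Templates) (n : ℕ) where
  open System T n hiding (HasDeadlock)

  step-of : ∀ {c t} → MovesAt c t → ∃ λ p → Step (st (c t)) (inp (c t)) p (st (c (suc t)))
  step-of ((p , _ , step) , _) = p , step

  module _ {P : GState → Set}
           (P-init : ∀ {s} → (∀ p → s p ≡ initState p) → P s)
           (P-step : ∀ {s e p s'} → Step s e p s' → P s → P s') where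

    invariant-infinite : ∀ {c} → InfiniteRun c → ∀ t → P (st (c t))
    invariant-infinite (init , _) zero = P-init init
    invariant-infinite {c} r@(_ , moves) (suc t) =
      P-step (proj₂ (step-of {c} (moves t))) (invariant-infinite r t)

    invariant-finite : ∀ {L c} → FiniteRun L c → ∀ t → t ≤ L → P (st (c t))
    invariant-finite (init , _) zero _ = P-init init
    invariant-finite {c = c} r@(_ , moves , _) (suc t) t<L =
      P-step (proj₂ (step-of {c} (moves t t<L))) (invariant-finite r t (<⇒≤ t<L))

    no-deadlock-if-invariant-enables : (∀ {s} e p → P s → Enabled s e p) → ¬ HasDeadlock T n
    no-deadlock-if-invariant-enables enabled (inj₁ (L , c , r@(_ , _ , _ , stuck))) =
      stuck pA (enabled _ pA (invariant-finite r L ≤-refl))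
    no-deadlock-if-invariant-enables enabled (inj₂ (c , r , p , t₀ , stuck)) =
      stuck t₀ ≤-refl (enabled _ p (invariant-infinite r t₀))

  _⟶[_]_ : GState → GInput → GState → Set
  s ⟶[ e ] s' = ∃ λ p → Step s e p s'

  _⟶*[_]_ : GState → GInput → GState → Set
  s ⟶*[ e ] s' = Star (_⟶[ e ]_) s s'

  module _ {e : GInput} where

    length : ∀ {s s'} → s ⟶*[ e ] s' → ℕ
    length ε        = 0
    length (_ ◅ xs) = suc (length xs)

    trace : ∀ {s s'} → s ⟶*[ e ] s' → ℕ → GState
    trace {s} _        zero    = s
    trace {s} ε        (suc _) = s
    trace     (_ ◅ xs) (suc t) = trace xs t

    mover : ∀ {s s'} → s ⟶*[ e ] s' → ℕ → Maybe (Proc n)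
    mover ε              _       = nothing
    mover ((p , _) ◅ _)  zero    = just p
    mover (_ ◅ xs)       (suc t) = mover xs t

    execution : ∀ {s s'} → s ⟶*[ e ] s' → ℕ → Config
    execution xs t = cfg (trace xs t) e (mover xs t)

    trace-length : ∀ {s s'} (xs : s ⟶*[ e ] s') → trace xs (length xs) ≡ s'
    trace-length ε        = refl
    trace-length (_ ◅ xs) = trace-length xs

    mover-length : ∀ {s s'} (xs : s ⟶*[ e ] s') → mover xs (length xs) ≡ nothing
    mover-length ε        = refl
    mover-length (_ ◅ xs) = mover-length xs

    execution-moves : ∀ {s s'} (xs : s ⟶*[ e ] s') t → t < length xs → MovesAt (execution xs) t
    execution-moves ((p , step) ◅ _) zero    _         = (p , refl , step) , λ _ _ → refl
    execution-moves (_ ◅ xs)         (suc t) (s≤s t<l) = execution-moves xs t t<l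

    globally-deadlocked : ∀ {s s'} → s ⟶*[ e ] s' → (∀ p → s p ≡ initState p) →
                          (∀ p → ¬ Enabled s' e p) → GloballyDeadlocked
    globally-deadlocked xs init stuck =
      length xs , execution xs , init , execution-moves xs , mover-length xs ,
      subst (λ s → ∀ p → ¬ Enabled s e p) (sym (trace-length xs)) stuck

module Construction (k : ℕ) where
  -- K ≥ 2 so that the system with K − 1 copies still contains a B, which A's idle loop needs.
  K : ℕ
  K = 2 + k

  Guard : Set
  Guard = Fin (suc K) ⊎ Fin K → Bool

  someB : Guard
  someB = [ const false , const true ]′

  bAt : Fin K → Guard
  bAt j = [ const false , (λ m → does (m ≟ j)) ]′

  aBelowTop : Guard
  aBelowTop = [ (λ a → does (toℕ a <? K)) , const false ]′

  waitA advanceA : Fin K → Trans (Fin (suc K)) (Fin 1) Guard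
  waitA    j = transition (inject₁ j) zero someB (inject₁ j)
  advanceA j = transition (inject₁ j) zero (bAt j) (suc j)

  waitB jumpB : Fin K → Trans (Fin K) (Fin 1) Guard
  waitB j = transition j zero aBelowTop j
  jumpB j = transition zero zero (bAt zero) j

  T : Templates
  T = record { qA = suc K ; qB = K ; σA = 1 ; σB = 1 ; initA = zero ; initB = zero
             ; δA = allFin₂ waitA advanceA
             ; δB = allFin₂ waitB jumpB }

  only-input : (x : Fin 1) → zero ≡ x
  only-input zero = refl

  module Occupancy {n : ℕ} where
    open System T n

    Occupied : GState → Fin K → Set
    Occupied s m = ∃ λ i → s (pB i) ≡ m

    Covered : GState → Set
    Covered s = ∀ m → toℕ m < toℕ (s pA) → Occupied s m

    A-move-inversion : ∀ {s e q} → EnabledTo s e pA q →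
                       q ≡ s pA ⊎ ∃ λ j → s pA ≡ inject₁ j × q ≡ suc j × Occupied s j
    A-move-inversion (viaA t t∈ src _ _) with ∈-allFin₂⁻ waitA advanceA t∈
    ... | j , inj₁ refl = inj₁ src
    A-move-inversion (viaA _ _ _   _ (pA   , A≢A , _))  | j , inj₂ refl = contradiction refl A≢A
    A-move-inversion (viaA _ _ src _ (pB i , _   , i∈)) | j , inj₂ refl =
      inj₂ (j , sym src , refl , i , does-sound (_ ≟ j) i∈)

    B-move-inversion : ∀ {s e i q} → EnabledTo s e (pB i) q →
                       q ≡ s (pB i) ⊎ s (pB i) ≡ zero × ∃ λ i' → pB i' ≢ pB i × s (pB i') ≡ zero
    B-move-inversion (viaB i t t∈ src _ _) with ∈-allFin₂⁻ waitB jumpB t∈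
    ... | j , inj₁ refl = inj₁ src
    B-move-inversion (viaB i _ _ src _ (pB i' , i'≢i , i'∈)) | j , inj₂ refl =
      inj₂ (sym src , i' , i'≢i , does-sound (_ ≟ zero) i'∈)

    B-step-preserves-Occupied : ∀ {s e i s'} → Step s e (pB i) s' → ∀ {m} → Occupied s m → Occupied s' m
    B-step-preserves-Occupied {i = i} (move , frame) (o , o∈m) with o ≟ i
    ... | no o≢i = o , trans (frame (pB o) (o≢i ∘ pB-injective)) o∈m
      where
        pB-injective : ∀ {a b} → pB {n} a ≡ pB b → a ≡ b
        pB-injective refl = refl
    ... | yes refl with B-move-inversion move
    ...   | inj₁ stays = i , trans stays o∈m
    ...   | inj₂ (left0 , i' , i'≢i , i'∈0) = i' , trans (frame (pB i') i'≢i) (trans i'∈0 (trans (sym left0) o∈m))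

    A-step-preserves-Occupied : ∀ {s e s'} → Step s e pA s' → ∀ {m} → Occupied s m → Occupied s' m
    A-step-preserves-Occupied (_ , frame) (i , i∈m) = i , trans (frame (pB i) λ ()) i∈m

    Covered-step : ∀ {s e p s'} → Step s e p s' → Covered s → Covered s'
    Covered-step {s} {p = pA} st@(move , _) covered m m<a' with A-move-inversion move
    ... | inj₁ stays =
      A-step-preserves-Occupied st (covered m (subst (λ a → toℕ m < toℕ a) stays m<a'))
    ... | inj₂ (j , a≡j , a'≡j+1 , j-occ) with m<1+n⇒m<n∨m≡n (subst (λ a → toℕ m < toℕ a) a'≡j+1 m<a')
    ...   | inj₂ m≡j = A-step-preserves-Occupied st (subst (Occupied s) (sym (toℕ-injective m≡j)) j-occ)
    ...   | inj₁ m<j = A-step-preserves-Occupied st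
                         (covered m (subst (toℕ m <_) (sym (trans (cong toℕ a≡j) (toℕ-inject₁ j))) m<j))
    Covered-step {p = pB _} st@(_ , frame) covered m m<a =
      B-step-preserves-Occupied st (covered m (subst (λ a → toℕ m < toℕ a) (frame pA λ ()) m<a))

  module FewerCopies where
    open System T (suc k) hiding (HasDeadlock)
    open Occupancy {suc k}

    A-below-top : ∀ {s} → Covered s → toℕ (s pA) < K
    A-below-top {s} covered with m<1+n⇒m<n∨m≡n (toℕ<n (s pA))
    ... | inj₁ a<K = a<K
    ... | inj₂ a≡K = contradiction (λ m → covered m (subst (toℕ m <_) (sym a≡K) (toℕ<n m)))
                                   (no-surjection-onto-larger ≤-refl (λ i → s (pB i)))

    Covered-initially : ∀ {s} → (∀ p → s p ≡ initState p) → Covered s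
    Covered-initially init m m<a = contradiction (subst (λ a → toℕ m < toℕ a) (init pA) m<a) λ ()

    Covered⇒enabled : ∀ {s} e p → Covered s → Enabled s e p
    Covered⇒enabled {s} e pA covered =
      inject₁ j , viaA (waitA j) (∈-allFin₂ˡ waitA advanceA j) a≡j (only-input (e pA)) (pB zero , (λ ()) , refl)
      where
        K≢a : K ≢ toℕ (s pA)
        K≢a K≡a = <-irrefl (sym K≡a) (A-below-top {s} covered)
        j : Fin K
        j = lower₁ (s pA) K≢a
        a≡j : inject₁ j ≡ s pA
        a≡j = inject₁-lower₁ (s pA) K≢a
    Covered⇒enabled {s} e (pB i) covered =
      s (pB i) , viaB i (waitB (s (pB i))) (∈-allFin₂ˡ waitB jumpB (s (pB i))) refl (only-input (e (pB i)))
                      (pA , (λ ()) , dec-true (toℕ (s pA) <? K) (A-below-top {s} covered))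

    no-deadlock : ¬ HasDeadlock T (suc k)
    no-deadlock = Executions.no-deadlock-if-invariant-enables T (suc k) Covered-initially Covered-step Covered⇒enabled

  module AllCopies where
    open System T K hiding (HasDeadlock)
    open Executions T K

    input : GInput
    input pA     = zero
    input (pB _) = zero

    scatteredB : ℕ → Fin K → Fin K
    scatteredB m i = if does (toℕ i ≤? m) then i else zero

    scattered : Fin (suc K) → ℕ → GState
    scattered a m pA     = a
    scattered a m (pB i) = scatteredB m i

    scatteredB-settled : ∀ {m i} → toℕ i ≤ m → scatteredB m i ≡ i
    scatteredB-settled {m} {i} i≤m rewrite dec-true (toℕ i ≤? m) i≤m = refl

    scatteredB-unsettled : ∀ {m i} → m < toℕ i → scatteredB m i ≡ zero
    scatteredB-unsettled {m} {i} m<i rewrite dec-false (toℕ i ≤? m) (<⇒≱ m<i) = refl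

    scattered-initial : ∀ p → scattered zero 0 p ≡ initState p
    scattered-initial pA           = refl
    scattered-initial (pB zero)    = refl
    scattered-initial (pB (suc i)) = refl

    jump : ∀ {a m} (m+1<K : suc m < K) → scattered a m ⟶[ input ] scattered a (suc m)
    jump {a} {m} m+1<K =
      pB j , subst (EnabledTo (scattered a m) input (pB j)) (sym (scatteredB-settled j≤m+1))
               (viaB j (jumpB j) (∈-allFin₂ʳ waitB jumpB j) (sym (scatteredB-unsettled m<j)) refl
                     (pB zero , B₀≢Bⱼ , dec-true (scattered a m (pB zero) ≟ zero) (scatteredB-settled {m} z≤n)))
           , frame
      where
        j : Fin K
        j = fromℕ< m+1<K
        j≤m+1 : toℕ j ≤ suc m
        j≤m+1 = ≤-reflexive (toℕ-fromℕ< m+1<K)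
        m<j : m < toℕ j
        m<j = ≤-reflexive (sym (toℕ-fromℕ< m+1<K))
        B₀≢Bⱼ : pB zero ≢ pB j
        B₀≢Bⱼ B₀≡Bⱼ with () ← trans (cong (λ { pA → 0 ; (pB i) → toℕ i }) B₀≡Bⱼ) (toℕ-fromℕ< m+1<K)
        frame : ∀ p → p ≢ pB j → scattered a (suc m) p ≡ scattered a m p
        frame pA _ = refl
        frame (pB i) Bᵢ≢Bⱼ with toℕ i ≤? m
        ... | yes i≤m = trans (scatteredB-settled (m≤n⇒m≤1+n i≤m)) (sym (scatteredB-settled i≤m))
        ... | no  i≰m = trans (scatteredB-unsettled (≤∧≢⇒< (≰⇒> i≰m) m+1≢i)) (sym (scatteredB-unsettled (≰⇒> i≰m)))
          where
            m+1≢i : suc m ≢ toℕ i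
            m+1≢i m+1≡i = Bᵢ≢Bⱼ (cong pB (toℕ-injective (trans (sym m+1≡i) (sym (toℕ-fromℕ< m+1<K)))))

    scatter : ∀ {a} m → m < K → scattered a 0 ⟶*[ input ] scattered a m
    scatter zero    _     = ε
    scatter (suc m) m+1<K = scatter m (<⇒≤ m+1<K) ◅◅ (jump m+1<K ◅ ε)

    advance : ∀ {m} j → toℕ j ≤ m → scattered (inject₁ j) m ⟶[ input ] scattered (suc j) m
    advance {m} j j≤m =
      pA , viaA (advanceA j) (∈-allFin₂ʳ waitA advanceA j) refl refl
                (pB j , (λ ()) , dec-true (scattered (inject₁ j) m (pB j) ≟ j) (scatteredB-settled j≤m))
         , frame
      where
        frame : ∀ p → p ≢ pA → scattered (suc j) m p ≡ scattered (inject₁ j) m p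
        frame pA A≢A = contradiction refl A≢A
        frame (pB _) _ = refl

    climb : ∀ a → scattered zero (suc k) ⟶*[ input ] scattered a (suc k)
    climb = <-weakInduction (λ a → scattered zero (suc k) ⟶*[ input ] scattered a (suc k))
              ε (λ j xs → xs ◅◅ (advance j (toℕ≤pred[n] j) ◅ ε))

    stuck : ∀ p → ¬ Enabled (scattered (fromℕ K) (suc k)) input p
    stuck pA (_ , viaA t t∈ src _ _) with ∈-allFin₂⁻ waitA advanceA t∈
    ... | j , inj₁ refl = fromℕ≢inject₁ (sym src)
    ... | j , inj₂ refl = fromℕ≢inject₁ (sym src)
    stuck (pB i) (_ , viaB i t t∈ src _ guard) with ∈-allFin₂⁻ waitB jumpB t∈ | guard
    ... | j , inj₁ refl | pA , _ , A<K =
      <-irrefl (toℕ-fromℕ K) (does-sound (toℕ (fromℕ K) <? K) A<K)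
    ... | j , inj₂ refl | pB i' , Bᵢ'≢Bᵢ , Bᵢ'∈0 =
      Bᵢ'≢Bᵢ (cong pB (trans (sym (settled i')) (trans (does-sound (_ ≟ zero) Bᵢ'∈0) (trans src (settled i)))))
      where
        settled : ∀ i → scattered (fromℕ K) (suc k) (pB i) ≡ i
        settled i = scatteredB-settled (toℕ≤pred[n] i)

    deadlock : HasDeadlock T K
    deadlock = inj₁ (globally-deadlocked (scatter (suc k) ≤-refl ◅◅ climb (fromℕ K)) scattered-initial stuck)

mainTheorem3 : (k : ℕ) → 2 ≤ k →
    Σ Templates (λ T → Templates.qB T ≡ k
    × ¬ HasDeadlock T (Templates.qB T ∸ 1)
    × HasDeadlock T (Templates.qB T))
mainTheorem3 (suc (suc k)) (s≤s (s≤s z≤n)) =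
  Construction.T k , refl , Construction.FewerCopies.no-deadlock k , Construction.AllCopies.deadlock k
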